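{- Let $\chi_1,\chi_2$ be Dirichlet characters modulo $q_1,q_2$ with $\chi_1\chi_2(-1)=1$, let $c\ge1$ with $q_1q_2\mid c$, and let $a,\overline{a}$ be integers with $a\overline{a}\equiv1\pmod c$. Then $S_{\chi_1,\chi_2}(\overline{a},c)=\chi_1(-a)\overline{\chi_2}(a)S_{\chi_1,\chi_2}(a,c)$.
   Context: Dirichlet characters are extended by $0$ to integers not coprime to their modulus. $B_1(x)=0$ if $x\in\mathbb{Z}$ and $B_1(x)=x-\lfloor x\rfloor-\tfrac12$ otherwise. For any integer $a$ and $c\ge1$ with $q_1q_2\mid c$, \[S_{\chi_1,\chi_2}(a,c)=\sum_{j\bmod c}\sum_{n\bmod q_1}\overline{\chi_2}(j)\overline{\chi_1}(n)B_1\!\Big(\frac{j}{c}\Big)B_1\!\Big(\frac{n}{q_1}+\frac{aj}{c}\Big).\] -}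

module Defs where

open import Level using (Level; suc; _⊔_)
open import Algebra.Bundles using (CommutativeRing)
open import Data.Nat as ℕ using (ℕ; NonZero)
open import Data.Nat.Coprimality using (Coprime)
open import Data.Integer as ℤ using (ℤ; +_; ∣_∣)
open import Data.Rational as ℚ using (ℚ; floor; ↧ₙ_; ½; 0ℚ; 1ℚ)
open import Data.Bool using (if_then_else_)
open import Relation.Nullary using (¬_)

-- The complex numbers are the intended model.
record StarQAlgebra (c ℓ : Level) : Set (suc (c ⊔ ℓ)) where
  field
    cring : CommutativeRing c ℓ
  open CommutativeRing cring public
  field
    ι      : ℚ → Carrier
    ι-+    : ∀ x y → ι (x ℚ.+ y) ≈ ι x + ι y
    ι-*    : ∀ x y → ι (x ℚ.* y) ≈ ι x * ι y
    ι-0    : ι 0ℚ ≈ 0#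
    ι-1    : ι 1ℚ ≈ 1#
    conj        : Carrier → Carrier
    conj-cong   : ∀ {x y} → x ≈ y → conj x ≈ conj y
    conj-+      : ∀ x y → conj (x + y) ≈ conj x + conj y
    conj-*      : ∀ x y → conj (x * y) ≈ conj x * conj y
    conj-1      : conj 1# ≈ 1#
    conj-invol  : ∀ x → conj (conj x) ≈ x
    conj-ι      : ∀ r → conj (ι r) ≈ ι r

-- Dirichlet character modulo q with values in A, extended by 0 to
-- integers not coprime to q.  Values at coprime integers have
-- modulus one: χ(n) · conj(χ(n)) = 1 (as for roots of unity in ℂ).
record DirichletCharacter {c ℓ} (A : StarQAlgebra c ℓ) (q : ℕ) .{{_ : NonZero q}}
       : Set (c ⊔ ℓ) where
  open StarQAlgebra A
  field
    χ         : ℤ → Carrier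
    periodic  : ∀ n → χ (n ℤ.+ + q) ≈ χ n
    mult      : ∀ m n → χ (m ℤ.* n) ≈ χ m * χ n
    χ-one     : χ (+ 1) ≈ 1#
    χ-zero    : ∀ n → ¬ Coprime ∣ n ∣ q → χ n ≈ 0#
    χ-unit    : ∀ n → Coprime ∣ n ∣ q → χ n * conj (χ n) ≈ 1#

B₁ : ℚ → ℚ
B₁ x = if (↧ₙ x) ℕ.≡ᵇ 1 then 0ℚ else (x ℚ.- (floor x ℚ./ 1)) ℚ.- ½

module _ {c ℓ} (A : StarQAlgebra c ℓ) where
  open StarQAlgebra A

  Σ< : ℕ → (ℕ → Carrier) → Carrier
  Σ< ℕ.zero    f = 0#
  Σ< (ℕ.suc n) f = Σ< n f + f n

  S : ∀ {q₁ q₂} .{{_ : NonZero q₁}} .{{_ : NonZero q₂}}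
      → DirichletCharacter A q₁ → DirichletCharacter A q₂
      → ℤ → (cc : ℕ) .{{_ : NonZero cc}} → Carrier
  S {q₁} χ₁ χ₂ a cc =
    Σ< cc λ j → Σ< q₁ λ n →
      conj (X₂ (+ j)) * conj (X₁ (+ n))
        * ι (B₁ ((+ j) ℚ./ cc))
        * ι (B₁ (((+ n) ℚ./ q₁) ℚ.+ ((a ℤ.* + j) ℚ./ cc)))
    where
      X₁ = DirichletCharacter.χ χ₁
      X₂ = DirichletCharacter.χ χ₂

{-# OPTIONS --safe #-}
module Submission where

-- Write c = q₁M.  Since n/q₁ + aj/c = (nM + aj)/c, S(a, c) is the sum over j mod c and n mod q₁
-- of χ̄₂(j) χ̄₁(n) B₁(j/c) B₁((nM + aj)/c), every factor being periodic in j mod c and in n mod q₁.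
-- Three changes of variables turn S(ā, c) into S(a, c).  The substitution j ↦ aj (a is a unit
-- mod c) pulls out χ̄₂(a) and leaves B₁((nM + j)/c) B₁(aj/c); the shift j ↦ j − nM, invisible to
-- χ̄₂ because q₂ ∣ M, turns this into B₁(j/c) B₁(a(j − nM)/c); finally n ↦ −ān (−ā is a unit mod
-- q₁) pulls out χ̄₁(−ā) = χ₁(−a) and restores the summand of S(a, c).

open import Defs
open import Function using (_∘_)
open import Data.Nat as ℕ using (ℕ; NonZero; zero; suc)
import Data.Nat.Properties as ℕ
import Data.Nat.Divisibility as ℕ
import Data.Nat.Tactic.RingSolver as ℕ-Solver
open import Data.Nat.Coprimality using (Coprime; coprime?)
open import Data.Integer as ℤ using (ℤ; +_; -_; 0ℤ; 1ℤ)
import Data.Integer.Properties as ℤ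
open import Data.Integer.DivMod using (_%_; n%d<d; a≡a%n+[a/n]*n) renaming (_/_ to _div_)
open import Data.Integer.Divisibility using (_∣_)
import Data.Integer.Divisibility.Signed as Signed
open import Data.Integer.Tactic.RingSolver using (solve)
open import Data.Rational as ℚ using (ℚ; mkℚ; fromℚᵘ; ½)
import Data.Rational.Properties as ℚ
open import Data.Rational.Unnormalised as ℚᵘ using (mkℚᵘ; *≡*)
import Data.Rational.Unnormalised.Properties as ℚᵘ
open import Data.Rational.Solver using (module +-*-Solver)
open import Data.Fin as Fin using (Fin; toℕ; fromℕ<)
import Data.Fin.Properties as Fin
open import Data.Fin.Permutation using (permutation)
open import Data.List using (_∷_; [])
open import Data.Product using (_×_; _,_; proj₁; proj₂)
open import Data.Empty using (⊥-elim)
open import Relation.Nullary using (¬_; yes; no)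
open import Relation.Binary.Bundles using (Setoid)
open import Relation.Binary.PropositionalEquality as ≡ using (_≡_; cong)
import Relation.Binary.Reasoning.Setoid as SetoidReasoning

infix 4 _≡_mod_

-- A record rather than a Σ-type, so that x, y and d can be inferred from a proof.
record _≡_mod_ (x y d : ℤ) : Set where
  constructor congruent
  field
    quotient : ℤ
    equality : x ≡ y ℤ.+ quotient ℤ.* d

module Congruences where
  open import Data.Integer.Base using (_+_; _*_; _-_)

  module _ {d : ℤ} where

    ≡mod-refl : ∀ {x} → x ≡ x mod d
    ≡mod-refl {x} = congruent 0ℤ (solve (x ∷ d ∷ []))

    ≡mod-reflexive : ∀ {x y} → x ≡ y → x ≡ y mod d
    ≡mod-reflexive ≡.refl = ≡mod-refl

    ≡mod-sym : ∀ {x y} → x ≡ y mod d → y ≡ x mod d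
    ≡mod-sym {y = y} (congruent k ≡.refl) = congruent (- k) (solve (y ∷ k ∷ d ∷ []))

    ≡mod-trans : ∀ {x y z} → x ≡ y mod d → y ≡ z mod d → x ≡ z mod d
    ≡mod-trans {z = z} (congruent k ≡.refl) (congruent l ≡.refl) =
      congruent (l + k) (solve (z ∷ l ∷ k ∷ d ∷ []))

    ≡mod-setoid : Setoid _ _
    ≡mod-setoid = record
      { _≈_           = λ x y → x ≡ y mod d
      ; isEquivalence = record
        { refl  = λ {x} → ≡mod-refl {x}
        ; sym   = λ {x y} → ≡mod-sym {x} {y}
        ; trans = λ {x y z} → ≡mod-trans {x} {y} {z}
        }
      }

    ≡mod-+ : ∀ {x x′ y y′} → x ≡ x′ mod d → y ≡ y′ mod d → x + y ≡ x′ + y′ mod d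
    ≡mod-+ {x′ = x′} {y′ = y′} (congruent k ≡.refl) (congruent l ≡.refl) =
      congruent (k + l) (solve (x′ ∷ y′ ∷ k ∷ l ∷ d ∷ []))

    ≡mod-neg : ∀ {x y} → x ≡ y mod d → - x ≡ - y mod d
    ≡mod-neg {y = y} (congruent k ≡.refl) = congruent (- k) (solve (y ∷ k ∷ d ∷ []))

    ≡mod-*ˡ : ∀ u {x y} → x ≡ y mod d → u * x ≡ u * y mod d
    ≡mod-*ˡ u {y = y} (congruent k ≡.refl) = congruent (u * k) (solve (u ∷ y ∷ k ∷ d ∷ []))

    ≡mod-*ʳ : ∀ u {x y} → x ≡ y mod d → x * u ≡ y * u mod d
    ≡mod-*ʳ u {y = y} (congruent k ≡.refl) = congruent (k * u) (solve (u ∷ y ∷ k ∷ d ∷ []))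

    ∣-⇒≡mod : ∀ {x y} → d Signed.∣ x - y → x ≡ y mod d
    ∣-⇒≡mod {x} {y} (Signed.divides k x-y≡kd) = congruent k (begin
      x               ≡⟨ solve (x ∷ y ∷ []) ⟩
      y + (x - y)     ≡⟨ cong (_+_ y) x-y≡kd ⟩
      y + k * d       ∎)
      where open ≡.≡-Reasoning

    unit-cancel : ∀ u v x → v * u ≡ 1ℤ mod d → v * (u * x) ≡ x mod d
    unit-cancel u v x vu≡1 = begin
      v * (u * x)   ≡⟨ ℤ.*-assoc v u x ⟨
      (v * u) * x   ≈⟨ ≡mod-*ʳ x vu≡1 ⟩
      1ℤ * x        ≡⟨ ℤ.*-identityˡ x ⟩
      x             ∎
      where open SetoidReasoning ≡mod-setoid

  affine-inverseˡ : ∀ {d} u v t x → v * u ≡ 1ℤ mod d → v * ((t + u * x) - t) ≡ x mod d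
  affine-inverseˡ {d} u v t x vu≡1 = begin
    v * ((t + u * x) - t)   ≡⟨ solve (v ∷ t ∷ u ∷ x ∷ []) ⟩
    v * (u * x)             ≈⟨ unit-cancel u v x vu≡1 ⟩
    x                       ∎
    where open SetoidReasoning (≡mod-setoid {d})

  affine-inverseʳ : ∀ {d} u v t x → v * u ≡ 1ℤ mod d → t + u * (v * (x - t)) ≡ x mod d
  affine-inverseʳ {d} u v t x vu≡1 = begin
    t + u * (v * (x - t))   ≈⟨ ≡mod-+ (≡mod-refl {x = t}) (unit-cancel v u (x - t) uv≡1) ⟩
    t + (x - t)             ≡⟨ solve (t ∷ x ∷ []) ⟩
    x                       ∎
    where
      open SetoidReasoning (≡mod-setoid {d})
      uv≡1 : u * v ≡ 1ℤ mod d
      uv≡1 = ≡mod-trans (≡mod-reflexive (ℤ.*-comm u v)) vu≡1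

  ≡mod-∣ : ∀ {d e x y} → d Signed.∣ e → x ≡ y mod e → x ≡ y mod d
  ≡mod-∣ {d} {y = y} (Signed.divides m ≡.refl) (congruent k ≡.refl) =
    congruent (k * m) (solve (y ∷ k ∷ m ∷ d ∷ []))

  ≡mod-*-scale : ∀ {d x y} e → x ≡ y mod d → x * e ≡ y * e mod d * e
  ≡mod-*-scale {d} {y = y} e (congruent k ≡.refl) = congruent k (solve (y ∷ k ∷ d ∷ e ∷ []))

  private
    moved-multiple : ∀ {a b c e} d → a + b * d ≡ c + e * d → a ≡ c + (e - b) * d
    moved-multiple {a} {b} {c} {e} d eq = begin
      a                   ≡⟨ solve (a ∷ b ∷ d ∷ []) ⟩
      (a + b * d) - b * d ≡⟨ cong (_- b * d) eq ⟩
      (c + e * d) - b * d ≡⟨ solve (c ∷ e ∷ b ∷ d ∷ []) ⟩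
      c + (e - b) * d     ∎
      where open ≡.≡-Reasoning

    not-remainder : ∀ {r r′ D} k → + r ≡ + r′ + + suc k * + D → ¬ r ℕ.< D
    not-remainder {r} {r′} {D} k eq r<D = ℕ.<⇒≱ r<D (begin
      D                    ≤⟨ ℕ.m≤m+n D (k ℕ.* D) ⟩
      suc k ℕ.* D          ≤⟨ ℕ.m≤n+m (suc k ℕ.* D) r′ ⟩
      r′ ℕ.+ suc k ℕ.* D   ≡⟨ ℤ.+-injective r≡r′+[1+k]D ⟨
      r                    ∎)
      where
        open ℕ.≤-Reasoning
        r≡r′+[1+k]D : + r ≡ + (r′ ℕ.+ suc k ℕ.* D)
        r≡r′+[1+k]D = ≡.trans eq (≡.sym (≡.trans (ℤ.pos-+ r′ (suc k ℕ.* D))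
                                          (cong (λ z → + r′ + z) (ℤ.pos-* (suc k) D))))

  quotient-remainder-unique : ∀ {D r r′ q q′} → r ℕ.< D → r′ ℕ.< D →
    + r + q * + D ≡ + r′ + q′ * + D → q ≡ q′ × r ≡ r′
  quotient-remainder-unique {D} {r} {r′} {q} {q′} r<D r′<D eq with q′ - q in δ
  ... | + zero   = q≡q′ , ℤ.+-injective r≡r′
    where
      r≡r′+δD : + r ≡ + r′ + (q′ - q) * + D
      r≡r′+δD = moved-multiple {+ r} {q} {+ r′} {q′} (+ D) eq
      r≡r′ : + r ≡ + r′
      r≡r′ = ≡.trans r≡r′+δD (≡.trans (cong (λ z → + r′ + z * + D) δ) (ℤ.+-identityʳ (+ r′)))
      q≡q′ : q ≡ q′
      q≡q′ = begin
        q              ≡⟨ ℤ.+-identityʳ q ⟨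
        q + 0ℤ         ≡⟨ cong (_+_ q) δ ⟨
        q + (q′ - q)   ≡⟨ solve (q ∷ q′ ∷ []) ⟩
        q′             ∎
        where open ≡.≡-Reasoning
  ... | + suc k  = ⊥-elim (not-remainder k r≡r′+[1+k]D r<D)
    where
      r≡r′+[1+k]D : + r ≡ + r′ + + suc k * + D
      r≡r′+[1+k]D = ≡.trans (moved-multiple {+ r} {q} {+ r′} {q′} (+ D) eq)
                            (cong (λ z → + r′ + z * + D) δ)
  ... | ℤ.-[1+ k ] = ⊥-elim (not-remainder k r′≡r+[1+k]D r′<D)
    where
      q-q′≡1+k : q - q′ ≡ + suc k
      q-q′≡1+k = begin
        q - q′       ≡⟨ solve (q ∷ q′ ∷ []) ⟩
        - (q′ - q)   ≡⟨ cong -_ δ ⟩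
        + suc k      ∎
        where open ≡.≡-Reasoning
      r′≡r+[1+k]D : + r′ ≡ + r + + suc k * + D
      r′≡r+[1+k]D = ≡.trans (moved-multiple {+ r′} {q′} {+ r} {q} (+ D) (≡.sym eq))
                            (cong (λ z → + r + z * + D) q-q′≡1+k)

  div-mod-unique : ∀ z D .{{_ : NonZero D}} {q r} → r ℕ.< D → z ≡ + r + q * + D →
                   z div + D ≡ q × z % + D ≡ r
  div-mod-unique z D r<D z≡r+qD =
    quotient-remainder-unique (n%d<d z (+ D)) r<D (≡.trans (≡.sym (a≡a%n+[a/n]*n z (+ D))) z≡r+qD)

  div-+-multiple : ∀ p D .{{_ : NonZero D}} t → (p + t * + D) div + D ≡ p div + D + t
  div-+-multiple p D t = proj₁ (div-mod-unique (p + t * + D) D (n%d<d p (+ D)) (begin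
    p + t * + D                           ≡⟨ cong (_+ t * + D) (a≡a%n+[a/n]*n p (+ D)) ⟩
    (+ r + p div + D * + D) + t * + D     ≡⟨ ℤ.+-assoc (+ r) (p div + D * + D) (t * + D) ⟩
    + r + (p div + D * + D + t * + D)     ≡⟨ cong (_+_ (+ r)) (ℤ.*-distribʳ-+ (+ D) (p div + D) t) ⟨
    + r + (p div + D + t) * + D           ∎))
    where
      open ≡.≡-Reasoning
      r : ℕ
      r = p % + D

  module _ (N : ℕ) .{{_ : NonZero N}} where

    reduce : ℤ → Fin N
    reduce z = fromℕ< (n%d<d z (+ N))

    ≡mod-reduce : ∀ z → z ≡ + toℕ (reduce z) mod + N
    ≡mod-reduce z = congruent (z div + N) (≡.trans (a≡a%n+[a/n]*n z (+ N))
      (cong (λ r → + r + z div + N * + N) (≡.sym (Fin.toℕ-fromℕ< (n%d<d z (+ N))))))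

    reduce-unique : ∀ {z} r → z ≡ + toℕ r mod + N → reduce z ≡ r
    reduce-unique {z} r (congruent k z≡r+kN) = Fin.toℕ-injective
      (≡.trans (Fin.toℕ-fromℕ< (n%d<d z (+ N))) (proj₂ (div-mod-unique z N {k} (Fin.toℕ<n r) z≡r+kN)))

open Congruences

module Bernoulli where
  open import Data.Integer.Base using (_+_; _*_; _-_)
  open import Data.Rational.Base using (_/_)

  fromℚᵘ-homo-+ : ∀ u v → fromℚᵘ (u ℚᵘ.+ v) ≡ fromℚᵘ u ℚ.+ fromℚᵘ v
  fromℚᵘ-homo-+ u v = ℚ.toℚᵘ-injective (begin
    ℚ.toℚᵘ (fromℚᵘ (u ℚᵘ.+ v))                 ≈⟨ ℚ.toℚᵘ-fromℚᵘ (u ℚᵘ.+ v) ⟩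
    u ℚᵘ.+ v                                   ≈⟨ ℚᵘ.+-cong (ℚ.toℚᵘ-fromℚᵘ u) (ℚ.toℚᵘ-fromℚᵘ v) ⟨
    ℚ.toℚᵘ (fromℚᵘ u) ℚᵘ.+ ℚ.toℚᵘ (fromℚᵘ v)   ≈⟨ ℚ.toℚᵘ-homo-+ (fromℚᵘ u) (fromℚᵘ v) ⟨
    ℚ.toℚᵘ (fromℚᵘ u ℚ.+ fromℚᵘ v)             ∎)
    where open ℚᵘ.≃-Reasoning

  /-+-/ : ∀ x y q c .{{_ : NonZero q}} .{{_ : NonZero c}} m → + c ≡ + q * m →
          x / q ℚ.+ y / c ≡ (x * m + y) / c
  /-+-/ x y q@(suc q-1) c@(suc c-1) m c≡qm = begin
    x / q ℚ.+ y / c                       ≡⟨ fromℚᵘ-homo-+ (mkℚᵘ x q-1) (mkℚᵘ y c-1) ⟨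
    fromℚᵘ (mkℚᵘ x q-1 ℚᵘ.+ mkℚᵘ y c-1)   ≡⟨ ℚ.fromℚᵘ-cong {mkℚᵘ x q-1 ℚᵘ.+ mkℚᵘ y c-1} {mkℚᵘ (x * m + y) c-1}
                                               (*≡* (cross-multiplied c≡qm (ℤ.pos-* q c))) ⟩
    (x * m + y) / c                       ∎
    where
      open ≡.≡-Reasoning
      cross-multiplied : ∀ {Q C QC} → C ≡ Q * m → QC ≡ Q * C → (x * C + y * Q) * C ≡ (x * m + y) * QC
      cross-multiplied {Q} ≡.refl ≡.refl = solve (x ∷ y ∷ Q ∷ m ∷ [])

  private
    coprime-+-multiple : ∀ p t D → Coprime ℤ.∣ p ∣ D → Coprime ℤ.∣ p + t * + D ∣ D
    coprime-+-multiple p t D coprime {i} (i∣p+tD , i∣D) = coprime (Signed.∣⇒∣ᵤ i∣p , i∣D)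
      where
        i∣p : + i Signed.∣ p
        i∣p = Signed.∣m+n∣n⇒∣m (Signed.∣ᵤ⇒∣ i∣p+tD) (Signed.∣n⇒∣m*n t (Signed.∣ᵤ⇒∣ i∣D))

  mkℚ-+-integer : ∀ p d .(coprime : Coprime ℤ.∣ p ∣ (suc d)) t →
    mkℚ p d coprime ℚ.+ t / 1 ≡ mkℚ (p + t * + suc d) d (coprime-+-multiple p t (suc d) coprime)
  mkℚ-+-integer p d coprime t = begin
    mkℚ p d coprime ℚ.+ t / 1   ≡⟨ ℚ.+-comm (mkℚ p d coprime) (t / 1) ⟩
    t / 1 ℚ.+ mkℚ p d coprime   ≡⟨ cong (t / 1 ℚ.+_) (ℚ.↥p/↧p≡p (mkℚ p d coprime)) ⟨
    t / 1 ℚ.+ p / suc d         ≡⟨ /-+-/ t p 1 (suc d) (+ suc d) (≡.sym (ℤ.*-identityˡ (+ suc d))) ⟩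
    (t * + suc d + p) / suc d   ≡⟨ cong (_/ suc d) (ℤ.+-comm (t * + suc d) p) ⟩
    (p + t * + suc d) / suc d   ≡⟨ ℚ.↥p/↧p≡p (mkℚ (p + t * + suc d) d _) ⟩
    mkℚ (p + t * + suc d) d _   ∎
    where open ≡.≡-Reasoning

  /1-homo-+ : ∀ a b → (a + b) / 1 ≡ a / 1 ℚ.+ b / 1
  /1-homo-+ a b = ≡.sym (≡.trans (/-+-/ a b 1 1 1ℤ ≡.refl) (cong (λ z → (z + b) / 1) (ℤ.*-identityʳ a)))

  B₁-periodic : ∀ y t → B₁ (y ℚ.+ t / 1) ≡ B₁ y
  B₁-periodic (mkℚ p zero coprime) t = cong B₁ (mkℚ-+-integer p zero coprime t)
  -- A denominator suc d ≥ 2 makes B₁ unfold definitionally, at y as well as at y′ = y + t.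
  B₁-periodic y@(mkℚ p d@(suc _) coprime) t = begin
    B₁ (y ℚ.+ t / 1)                                  ≡⟨ cong B₁ y+t≡y′ ⟩
    (y′ ℚ.- ⌊y′⌋ / 1) ℚ.- ½                            ≡⟨ cong (λ z → (z ℚ.- ⌊y′⌋ / 1) ℚ.- ½) y+t≡y′ ⟨
    ((y ℚ.+ t / 1) ℚ.- ⌊y′⌋ / 1) ℚ.- ½                 ≡⟨ cong (λ z → ((y ℚ.+ t / 1) ℚ.- z) ℚ.- ½) ⌊y′⌋≡⌊y⌋+t ⟩
    ((y ℚ.+ t / 1) ℚ.- (⌊y⌋ / 1 ℚ.+ t / 1)) ℚ.- ½      ≡⟨ cong (ℚ._- ½) (cancel-t y (⌊y⌋ / 1) (t / 1)) ⟩
    (y ℚ.- ⌊y⌋ / 1) ℚ.- ½                              ∎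
    where
      open ≡.≡-Reasoning
      D ⌊y⌋ ⌊y′⌋ : ℤ
      D = + suc d
      ⌊y⌋ = p div D
      ⌊y′⌋ = (p + t * D) div D
      y′ : ℚ
      y′ = mkℚ (p + t * D) d (coprime-+-multiple p t (suc d) coprime)
      y+t≡y′ : y ℚ.+ t / 1 ≡ y′
      y+t≡y′ = mkℚ-+-integer p d coprime t
      ⌊y′⌋≡⌊y⌋+t : ⌊y′⌋ / 1 ≡ ⌊y⌋ / 1 ℚ.+ t / 1
      ⌊y′⌋≡⌊y⌋+t = ≡.trans (cong (_/ 1) (div-+-multiple p (suc d) t)) (/1-homo-+ ⌊y⌋ t)
      cancel-t : ∀ y f t → (y ℚ.+ t) ℚ.- (f ℚ.+ t) ≡ y ℚ.- f
      cancel-t = +-*-Solver.solve 3 (λ y f t → (y :+ t) :- (f :+ t) := y :- f) ≡.refl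
        where open +-*-Solver using (_:+_; _:-_; _:=_)

  B₁-/-periodic : ∀ x k c .{{_ : NonZero c}} → B₁ ((x + k * + c) / c) ≡ B₁ (x / c)
  B₁-/-periodic x k c = ≡.trans (cong B₁ x/c+k) (B₁-periodic (x / c) k)
    where
      x/c+k : (x + k * + c) / c ≡ x / c ℚ.+ k / 1
      x/c+k = begin
        (x + k * + c) / c     ≡⟨ cong (_/ c) (ℤ.+-comm x (k * + c)) ⟩
        (k * + c + x) / c     ≡⟨ /-+-/ k x 1 c (+ c) (≡.sym (ℤ.*-identityˡ (+ c))) ⟨
        k / 1 ℚ.+ x / c       ≡⟨ ℚ.+-comm (k / 1) (x / c) ⟩
        x / c ℚ.+ k / 1       ∎
        where open ≡.≡-Reasoning

open Bernoulli

module _ {c ℓ} (A : StarQAlgebra c ℓ) where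
  open StarQAlgebra A hiding (-_)
  open SetoidReasoning setoid
  open import Algebra.Properties.CommutativeMonoid.Sum +-commutativeMonoid
    using (sum; sum-cong-≋; ∑-comm; sum-permute)

  Σ<-cong : ∀ n {f g : ℕ → Carrier} → (∀ k → f k ≈ g k) → Σ< A n f ≈ Σ< A n g
  Σ<-cong zero    f≈g = refl
  Σ<-cong (suc n) f≈g = +-cong (Σ<-cong n f≈g) (f≈g n)

  Σ<-head : ∀ n (f : ℕ → Carrier) → Σ< A (suc n) f ≈ f 0 + Σ< A n (f ∘ suc)
  Σ<-head zero    f = trans (+-identityˡ (f 0)) (sym (+-identityʳ (f 0)))
  Σ<-head (suc n) f = trans (+-congʳ (Σ<-head n f)) (+-assoc _ _ _)

  Σ<≈sum : ∀ n (f : ℕ → Carrier) → Σ< A n f ≈ sum {n} (f ∘ toℕ)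
  Σ<≈sum zero    f = refl
  Σ<≈sum (suc n) f = trans (Σ<-head n f) (+-congˡ (Σ<≈sum n (f ∘ suc)))

  Σ<-comm : ∀ m n (f : ℕ → ℕ → Carrier) →
            Σ< A m (λ i → Σ< A n (f i)) ≈ Σ< A n (λ j → Σ< A m (λ i → f i j))
  Σ<-comm m n f = begin
    Σ< A m (λ i → Σ< A n (f i))                         ≈⟨ Σ<-cong m (λ i → Σ<≈sum n (f i)) ⟩
    Σ< A m (λ i → sum {n} (f i ∘ toℕ))                  ≈⟨ Σ<≈sum m _ ⟩
    sum {m} (λ i → sum {n} (λ j → f (toℕ i) (toℕ j)))   ≈⟨ ∑-comm {m} {n} (λ i j → f (toℕ i) (toℕ j)) ⟩
    sum {n} (λ j → sum {m} (λ i → f (toℕ i) (toℕ j)))   ≈⟨ Σ<≈sum n (λ j → sum {m} (λ i → f (toℕ i) j)) ⟨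
    Σ< A n (λ j → sum {m} (λ i → f (toℕ i) j))          ≈⟨ Σ<-cong n (λ j → Σ<≈sum m (λ i → f i j)) ⟨
    Σ< A n (λ j → Σ< A m (λ i → f i j))                 ∎

  *-distribˡ-Σ< : ∀ n x (f : ℕ → Carrier) → x * Σ< A n f ≈ Σ< A n (λ k → x * f k)
  *-distribˡ-Σ< zero    x f = zeroʳ x
  *-distribˡ-Σ< (suc n) x f = trans (distribˡ x _ _) (+-congʳ (*-distribˡ-Σ< n x f))

  Periodic : ℤ → (ℤ → Carrier) → Set _
  Periodic d f = ∀ {x y} → x ≡ y mod d → f x ≈ f y

  periodic-from-shift : ∀ {d f} → (∀ x → f (x ℤ.+ d) ≈ f x) → Periodic d f
  periodic-from-shift {d} {f} shift {y = y} (congruent k ≡.refl) = +-multiple y k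
    where
      add-one : ∀ x k → x ℤ.+ (1ℤ ℤ.+ k) ℤ.* d ≡ (x ℤ.+ k ℤ.* d) ℤ.+ d
      add-one x k = solve (x ∷ k ∷ d ∷ [])

      cancel : ∀ x k → (x ℤ.+ - k ℤ.* d) ℤ.+ k ℤ.* d ≡ x
      cancel x k = solve (x ∷ k ∷ d ∷ [])

      +-multiple⁺ : ∀ x k → f (x ℤ.+ + k ℤ.* d) ≈ f x
      +-multiple⁺ x zero    = reflexive (cong f (ℤ.+-identityʳ x))
      +-multiple⁺ x (suc k) = begin
        f (x ℤ.+ + suc k ℤ.* d)       ≡⟨ cong f (add-one x (+ k)) ⟩
        f ((x ℤ.+ + k ℤ.* d) ℤ.+ d)   ≈⟨ shift (x ℤ.+ + k ℤ.* d) ⟩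
        f (x ℤ.+ + k ℤ.* d)           ≈⟨ +-multiple⁺ x k ⟩
        f x                           ∎

      +-multiple : ∀ x k → f (x ℤ.+ k ℤ.* d) ≈ f x
      +-multiple x (+ k)      = +-multiple⁺ x k
      +-multiple x ℤ.-[1+ k ] = begin
        f x′                            ≈⟨ +-multiple⁺ x′ (suc k) ⟨
        f (x′ ℤ.+ + suc k ℤ.* d)        ≡⟨ cong f (cancel x (+ suc k)) ⟩
        f x                             ∎
        where
          x′ : ℤ
          x′ = x ℤ.+ ℤ.-[1+ k ] ℤ.* d

  periodic-∣ : ∀ {d e f} → d Signed.∣ e → Periodic d f → Periodic e f
  periodic-∣ d∣e f-periodic x≡y = f-periodic (≡mod-∣ d∣e x≡y)

  module _ (N : ℕ) .{{_ : NonZero N}} {f : ℤ → Carrier} (f-periodic : Periodic (+ N) f) where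

    Σ<-reindex : ∀ u v t → v ℤ.* u ≡ 1ℤ mod + N →
                 Σ< A N (f ∘ +_) ≈ Σ< A N (λ j → f (t ℤ.+ u ℤ.* + j))
    Σ<-reindex u v t vu≡1 = begin
      Σ< A N (f ∘ +_)                      ≈⟨ Σ<≈sum N _ ⟩
      sum {N} (λ i → f (+ toℕ i))          ≈⟨ sum-permute _ (permutation σ τ σ∘τ≗id τ∘σ≗id) ⟩
      sum {N} (λ i → f (+ toℕ (σ i)))      ≈⟨ sum-cong-≋ (λ i → f-periodic (≡mod-sym (≡mod-reduce N (affine i)))) ⟩
      sum {N} (λ i → f (affine i))         ≈⟨ Σ<≈sum N _ ⟨
      Σ< A N (λ j → f (t ℤ.+ u ℤ.* + j))   ∎
      where
        affine : Fin N → ℤ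
        affine i = t ℤ.+ u ℤ.* + toℕ i
        σ τ : Fin N → Fin N
        σ i = reduce N (affine i)
        τ i = reduce N (v ℤ.* (+ toℕ i ℤ.- t))
        σ∘τ≗id : ∀ i → σ (τ i) ≡ i
        σ∘τ≗id i = reduce-unique N i (≡mod-trans
          (≡mod-+ (≡mod-refl {x = t}) (≡mod-*ˡ u (≡mod-sym (≡mod-reduce N _))))
          (affine-inverseʳ u v t (+ toℕ i) vu≡1))
        τ∘σ≗id : ∀ i → τ (σ i) ≡ i
        τ∘σ≗id i = reduce-unique N i (≡mod-trans
          (≡mod-*ˡ v (≡mod-+ (≡mod-sym (≡mod-reduce N (affine i))) (≡mod-refl {x = - t})))
          (affine-inverseˡ u v t (+ toℕ i) vu≡1))

    Σ<-scale : ∀ u v → v ℤ.* u ≡ 1ℤ mod + N → Σ< A N (f ∘ +_) ≈ Σ< A N (λ j → f (u ℤ.* + j))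
    Σ<-scale u v vu≡1 = trans (Σ<-reindex u v 0ℤ vu≡1) (Σ<-cong N λ j →
      reflexive (cong f (ℤ.+-identityˡ (u ℤ.* + j))))

    Σ<-translate : ∀ t → Σ< A N (f ∘ +_) ≈ Σ< A N (λ j → f (+ j ℤ.+ t))
    Σ<-translate t = trans (Σ<-reindex 1ℤ 1ℤ t ≡mod-refl) (Σ<-cong N λ j →
      reflexive (cong f (≡.trans (cong (ℤ._+_ t) (ℤ.*-identityˡ (+ j))) (ℤ.+-comm t (+ j)))))

module _ {c ℓ} {A : StarQAlgebra c ℓ} {q} .{{_ : NonZero q}} (ψ : DirichletCharacter A q) where
  open StarQAlgebra A hiding (-_)
  open DirichletCharacter ψ

  χ-periodic : Periodic A (+ q) χ
  χ-periodic = periodic-from-shift A periodic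

  conj∘χ-periodic : Periodic A (+ q) (conj ∘ χ)
  conj∘χ-periodic x≡y = conj-cong (χ-periodic x≡y)

  conj∘χ-mult : ∀ m n → conj (χ (m ℤ.* n)) ≈ conj (χ m) * conj (χ n)
  conj∘χ-mult m n = trans (conj-cong (mult m n)) (conj-* (χ m) (χ n))

  χ-inverse : ∀ {a ā} → a ℤ.* ā ≡ 1ℤ mod + q → χ a * χ ā ≈ 1#
  χ-inverse {a} {ā} aā≡1 = trans (sym (mult a ā)) (trans (χ-periodic aā≡1) χ-one)

  conj-χ-inverse : ∀ {a ā} → a ℤ.* ā ≡ 1ℤ mod + q → conj (χ ā) ≈ χ a
  conj-χ-inverse {a} {ā} aā≡1 with coprime? ℤ.∣ ā ∣ q
  ... | yes ā-unit = begin
    conj (χ ā)                   ≈⟨ *-identityˡ (conj (χ ā)) ⟨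
    1# * conj (χ ā)              ≈⟨ *-congʳ (χ-inverse aā≡1) ⟨
    (χ a * χ ā) * conj (χ ā)     ≈⟨ *-assoc (χ a) (χ ā) (conj (χ ā)) ⟩
    χ a * (χ ā * conj (χ ā))     ≈⟨ *-congˡ (χ-unit ā ā-unit) ⟩
    χ a * 1#                     ≈⟨ *-identityʳ (χ a) ⟩
    χ a                          ∎
    where open SetoidReasoning setoid
  ... | no ā-nonunit = trans (trivial (conj (χ ā))) (sym (trivial (χ a)))
    where
      1≈0 : 1# ≈ 0#
      1≈0 = trans (sym (χ-inverse aā≡1)) (trans (*-congˡ (χ-zero ā ā-nonunit)) (zeroʳ (χ a)))
      trivial : ∀ x → x ≈ 0#
      trivial x = trans (sym (*-identityʳ x)) (trans (*-congˡ 1≈0) (zeroʳ x))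

module Reciprocity {c ℓ} (A : StarQAlgebra c ℓ) {q₁ q₂} .{{_ : NonZero q₁}} .{{_ : NonZero q₂}}
  (χ₁ : DirichletCharacter A q₁) (χ₂ : DirichletCharacter A q₂)
  (cc : ℕ) .{{_ : NonZero cc}} (M : ℤ) (c≡q₁M : + cc ≡ + q₁ ℤ.* M) (q₂∣M : + q₂ Signed.∣ M)
  (a ā : ℤ) (aā≡1 : a ℤ.* ā ≡ 1ℤ mod + cc) where

  open StarQAlgebra A hiding (-_)
  import Algebra.Solver.CommutativeMonoid *-commutativeMonoid as *-Solver
  open *-Solver using (_⊕_; _⊜_)

  χ̄₁ χ̄₂ : ℤ → Carrier
  χ̄₁ = conj ∘ DirichletCharacter.χ χ₁
  χ̄₂ = conj ∘ DirichletCharacter.χ χ₂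

  B : ℤ → Carrier
  B x = ι (B₁ (x ℚ./ cc))

  term : ℤ → ℤ → ℤ → Carrier
  term u j n = ((χ̄₂ j * χ̄₁ n) * B j) * B (n ℤ.* M ℤ.+ u ℤ.* j)

  ΣΣ : (ℤ → ℤ → Carrier) → Carrier
  ΣΣ f = Σ< A cc (λ j → Σ< A q₁ (λ n → f (+ j) (+ n)))

  S≈ΣΣ-term : ∀ u → S A χ₁ χ₂ u cc ≈ ΣΣ (term u)
  S≈ΣΣ-term u = Σ<-cong A cc λ j → Σ<-cong A q₁ λ n →
    *-congˡ (reflexive (cong (ι ∘ B₁) (/-+-/ (+ n) (u ℤ.* + j) q₁ cc M c≡q₁M)))

  ΣΣ-* : ∀ x f → ΣΣ (λ j n → x * f j n) ≈ x * ΣΣ f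
  ΣΣ-* x f = sym (trans (*-distribˡ-Σ< A cc x _) (Σ<-cong A cc λ j → *-distribˡ-Σ< A q₁ x _))

  q₁∣c : + q₁ Signed.∣ + cc
  q₁∣c = Signed.divides M (≡.trans c≡q₁M (ℤ.*-comm (+ q₁) M))

  q₂∣c : + q₂ Signed.∣ + cc
  q₂∣c = Signed.∣-trans q₂∣M (Signed.divides (+ q₁) c≡q₁M)

  B-periodic : Periodic A (+ cc) B
  B-periodic {y = y} (congruent k ≡.refl) = reflexive (cong ι (B₁-/-periodic y k cc))

  χ̄₂-periodic : Periodic A (+ cc) χ̄₂
  χ̄₂-periodic = periodic-∣ A q₂∣c (conj∘χ-periodic χ₂)

  āa≡1 : ā ℤ.* a ≡ 1ℤ mod + cc
  āa≡1 = ≡mod-trans (≡mod-reflexive (ℤ.*-comm ā a)) aā≡1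

  [-a][-ā]≡1 : ℤ.- a ℤ.* ℤ.- ā ≡ 1ℤ mod + q₁
  [-a][-ā]≡1 = ≡mod-∣ q₁∣c (≡mod-trans (≡mod-reflexive [-a][-ā]≡aā) aā≡1)
    where
      [-a][-ā]≡aā : ℤ.- a ℤ.* ℤ.- ā ≡ a ℤ.* ā
      [-a][-ā]≡aā = solve (a ∷ ā ∷ [])

  term₁ : ℤ → ℤ → Carrier
  term₁ j n = ((χ̄₂ j * χ̄₁ n) * B (n ℤ.* M ℤ.+ j)) * B (a ℤ.* j)

  term-ā-at-a : ∀ j n → term ā (a ℤ.* j) n ≈ χ̄₂ a * term₁ j n
  term-ā-at-a j n = begin
    ((χ̄₂ (a ℤ.* j) * χ̄₁ n) * B (a ℤ.* j)) * B (n ℤ.* M ℤ.+ ā ℤ.* (a ℤ.* j))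
      ≈⟨ *-cong (*-congʳ (*-congʳ (conj∘χ-mult χ₂ a j)))
                (B-periodic (≡mod-+ (≡mod-refl {x = n ℤ.* M}) (unit-cancel a ā j āa≡1))) ⟩
    (((χ̄₂ a * χ̄₂ j) * χ̄₁ n) * B (a ℤ.* j)) * B (n ℤ.* M ℤ.+ j)
      ≈⟨ *-Solver.solve 5 (λ x y z u w → (((x ⊕ y) ⊕ z) ⊕ u) ⊕ w ⊜ x ⊕ (((y ⊕ z) ⊕ w) ⊕ u))
                          refl _ _ _ _ _ ⟩
    χ̄₂ a * term₁ j n
      ∎
    where open SetoidReasoning setoid

  ΣΣ-reindex-a : ΣΣ (term ā) ≈ χ̄₂ a * ΣΣ term₁
  ΣΣ-reindex-a = begin
    ΣΣ (term ā)
      ≈⟨ Σ<-scale A cc F-periodic a ā āa≡1 ⟩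
    Σ< A cc (λ j → F (a ℤ.* + j))
      ≈⟨ Σ<-cong A cc (λ j → Σ<-cong A q₁ (λ n → term-ā-at-a (+ j) (+ n))) ⟩
    ΣΣ (λ j n → χ̄₂ a * term₁ j n)
      ≈⟨ ΣΣ-* (χ̄₂ a) term₁ ⟩
    χ̄₂ a * ΣΣ term₁
      ∎
    where
      open SetoidReasoning setoid
      F : ℤ → Carrier
      F j = Σ< A q₁ (λ n → term ā j (+ n))
      F-periodic : Periodic A (+ cc) F
      F-periodic j≡j′ = Σ<-cong A q₁ λ n →
        *-cong (*-cong (*-congʳ (χ̄₂-periodic j≡j′)) (B-periodic j≡j′))
               (B-periodic (≡mod-+ (≡mod-refl {x = + n ℤ.* M}) (≡mod-*ˡ ā j≡j′)))

  term₂ : ℤ → ℤ → Carrier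
  term₂ j n = ((χ̄₂ j * χ̄₁ n) * B j) * B (a ℤ.* (j ℤ.- n ℤ.* M))

  term₁-shifted : ∀ j n → term₁ (j ℤ.- n ℤ.* M) n ≈ term₂ j n
  term₁-shifted j n =
    *-congʳ (*-cong (*-congʳ (conj∘χ-periodic χ₂ j-nM≡j)) (reflexive (cong B nM+[j-nM]≡j)))
    where
      j-nM≡j : j ℤ.- n ℤ.* M ≡ j mod + q₂
      j-nM≡j = ≡mod-∣ q₂∣M (congruent (ℤ.- n) (solve (j ∷ n ∷ M ∷ [])))
      nM+[j-nM]≡j : n ℤ.* M ℤ.+ (j ℤ.- n ℤ.* M) ≡ j
      nM+[j-nM]≡j = solve (n ∷ M ∷ j ∷ [])

  ΣΣ-shift : ΣΣ term₁ ≈ ΣΣ term₂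
  ΣΣ-shift = begin
    ΣΣ term₁
      ≈⟨ Σ<-comm A cc q₁ _ ⟩
    Σ< A q₁ (λ n → Σ< A cc (λ j → term₁ (+ j) (+ n)))
      ≈⟨ Σ<-cong A q₁ (λ n → Σ<-translate A cc (term₁-periodic (+ n)) (ℤ.- (+ n ℤ.* M))) ⟩
    Σ< A q₁ (λ n → Σ< A cc (λ j → term₁ (+ j ℤ.- + n ℤ.* M) (+ n)))
      ≈⟨ Σ<-cong A q₁ (λ n → Σ<-cong A cc (λ j → term₁-shifted (+ j) (+ n))) ⟩
    Σ< A q₁ (λ n → Σ< A cc (λ j → term₂ (+ j) (+ n)))
      ≈⟨ Σ<-comm A q₁ cc _ ⟩
    ΣΣ term₂
      ∎
    where
      open SetoidReasoning setoid
      term₁-periodic : ∀ n → Periodic A (+ cc) (λ j → term₁ j n)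
      term₁-periodic n j≡j′ =
        *-cong (*-cong (*-congʳ (χ̄₂-periodic j≡j′))
                       (B-periodic (≡mod-+ (≡mod-refl {x = n ℤ.* M}) j≡j′)))
               (B-periodic (≡mod-*ˡ a j≡j′))

  index-at-minus-ā : ∀ j n → a ℤ.* (j ℤ.- (ℤ.- ā ℤ.* n) ℤ.* M) ≡ n ℤ.* M ℤ.+ a ℤ.* j mod + cc
  index-at-minus-ā j n = begin
    a ℤ.* (j ℤ.- (ℤ.- ā ℤ.* n) ℤ.* M)    ≡⟨ solve (a ∷ j ∷ ā ∷ n ∷ M ∷ []) ⟩
    (a ℤ.* ā) ℤ.* (n ℤ.* M) ℤ.+ a ℤ.* j  ≈⟨ ≡mod-+ (≡mod-*ʳ (n ℤ.* M) aā≡1) ≡mod-refl ⟩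
    1ℤ ℤ.* (n ℤ.* M) ℤ.+ a ℤ.* j         ≡⟨ cong (ℤ._+ a ℤ.* j) (ℤ.*-identityˡ (n ℤ.* M)) ⟩
    n ℤ.* M ℤ.+ a ℤ.* j                  ∎
    where open SetoidReasoning ≡mod-setoid

  term₂-at-minus-ā : ∀ j n → term₂ j (ℤ.- ā ℤ.* n) ≈ χ̄₁ (ℤ.- ā) * term a j n
  term₂-at-minus-ā j n = begin
    ((χ̄₂ j * χ̄₁ (ℤ.- ā ℤ.* n)) * B j) * B (a ℤ.* (j ℤ.- (ℤ.- ā ℤ.* n) ℤ.* M))
      ≈⟨ *-cong (*-congʳ (*-congˡ (conj∘χ-mult χ₁ (ℤ.- ā) n))) (B-periodic (index-at-minus-ā j n)) ⟩
    ((χ̄₂ j * (χ̄₁ (ℤ.- ā) * χ̄₁ n)) * B j) * B (n ℤ.* M ℤ.+ a ℤ.* j)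
      ≈⟨ *-Solver.solve 5 (λ x y z u w → ((y ⊕ (x ⊕ z)) ⊕ u) ⊕ w ⊜ x ⊕ (((y ⊕ z) ⊕ u) ⊕ w))
                          refl _ _ _ _ _ ⟩
    χ̄₁ (ℤ.- ā) * term a j n
      ∎
    where open SetoidReasoning setoid

  ΣΣ-reindex-minus-ā : ΣΣ term₂ ≈ χ̄₁ (ℤ.- ā) * ΣΣ (term a)
  ΣΣ-reindex-minus-ā = begin
    ΣΣ term₂
      ≈⟨ Σ<-cong A cc (λ j → Σ<-scale A q₁ (term₂-periodic (+ j)) (ℤ.- ā) (ℤ.- a) [-a][-ā]≡1) ⟩
    Σ< A cc (λ j → Σ< A q₁ (λ n → term₂ (+ j) (ℤ.- ā ℤ.* + n)))
      ≈⟨ Σ<-cong A cc (λ j → Σ<-cong A q₁ (λ n → term₂-at-minus-ā (+ j) (+ n))) ⟩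
    ΣΣ (λ j n → χ̄₁ (ℤ.- ā) * term a j n)
      ≈⟨ ΣΣ-* (χ̄₁ (ℤ.- ā)) (term a) ⟩
    χ̄₁ (ℤ.- ā) * ΣΣ (term a)
      ∎
    where
      open SetoidReasoning setoid
      term₂-periodic : ∀ j → Periodic A (+ q₁) (term₂ j)
      term₂-periodic j {n} {n′} n≡n′ =
        *-cong (*-congʳ (*-congˡ (conj∘χ-periodic χ₁ n≡n′)))
               (B-periodic (≡mod-*ˡ a (≡mod-+ (≡mod-refl {x = j}) (≡mod-neg nM≡n′M))))
        where
          nM≡n′M : n ℤ.* M ≡ n′ ℤ.* M mod + cc
          nM≡n′M = ≡.subst (λ d → _ ≡ _ mod d) (≡.sym c≡q₁M) (≡mod-*-scale M n≡n′)

proposition2p4 : ∀ {c ℓ} (A : StarQAlgebra c ℓ) (q₁ q₂ : ℕ) .{{_ : NonZero q₁}} .{{_ : NonZero q₂}}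
    (χ₁ : DirichletCharacter A q₁) (χ₂ : DirichletCharacter A q₂)
    → StarQAlgebra._≈_ A (StarQAlgebra._*_ A (DirichletCharacter.χ χ₁ (- + 1)) (DirichletCharacter.χ χ₂ (- + 1))) (StarQAlgebra.1# A)
    → (cc : ℕ) .{{_ : NonZero cc}} → (+ (q₁ ℕ.* q₂)) ∣ (+ cc)
    → (a ā : ℤ) → (+ cc) ∣ ((a ℤ.* ā) ℤ.- + 1)
    → StarQAlgebra._≈_ A (S A χ₁ χ₂ ā cc)
        (StarQAlgebra._*_ A (StarQAlgebra._*_ A (DirichletCharacter.χ χ₁ (- a)) (StarQAlgebra.conj A (DirichletCharacter.χ χ₂ a))) (S A χ₁ χ₂ a cc))
proposition2p4 A q₁ q₂ χ₁ χ₂ _ cc (ℕ.divides k c≡k[q₁q₂]) a ā c∣aā-1 = begin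
  S A χ₁ χ₂ ā cc                                  ≈⟨ S≈ΣΣ-term ā ⟩
  ΣΣ (term ā)                                     ≈⟨ ΣΣ-reindex-a ⟩
  χ̄₂ a * ΣΣ term₁                                 ≈⟨ *-congˡ ΣΣ-shift ⟩
  χ̄₂ a * ΣΣ term₂                                 ≈⟨ *-congˡ ΣΣ-reindex-minus-ā ⟩
  χ̄₂ a * (χ̄₁ (- ā) * ΣΣ (term a))                 ≈⟨ *-assoc (χ̄₂ a) (χ̄₁ (- ā)) (ΣΣ (term a)) ⟨
  (χ̄₂ a * χ̄₁ (- ā)) * ΣΣ (term a)                 ≈⟨ *-cong (*-comm (χ̄₁ (- ā)) (χ̄₂ a)) (S≈ΣΣ-term a) ⟨
  (χ̄₁ (- ā) * χ̄₂ a) * S A χ₁ χ₂ a cc              ≈⟨ *-congʳ (*-congʳ (conj-χ-inverse χ₁ [-a][-ā]≡1)) ⟩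
  (DirichletCharacter.χ χ₁ (- a) * χ̄₂ a) * S A χ₁ χ₂ a cc ∎
  where
    open StarQAlgebra A hiding (-_)
    open SetoidReasoning setoid
    c≡q₁M : + cc ≡ + q₁ ℤ.* + (k ℕ.* q₂)
    c≡q₁M = ≡.trans (cong +_ (≡.trans c≡k[q₁q₂] k[q₁q₂]≡q₁[kq₂])) (ℤ.pos-* q₁ (k ℕ.* q₂))
      where
        k[q₁q₂]≡q₁[kq₂] : k ℕ.* (q₁ ℕ.* q₂) ≡ q₁ ℕ.* (k ℕ.* q₂)
        k[q₁q₂]≡q₁[kq₂] = ℕ-Solver.solve (k ∷ q₁ ∷ q₂ ∷ [])
    open Reciprocity A χ₁ χ₂ cc (+ (k ℕ.* q₂)) c≡q₁M (Signed.divides (+ k) (ℤ.pos-* k q₂))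
                     a ā (∣-⇒≡mod (Signed.∣ᵤ⇒∣ c∣aā-1))
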